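{- Let $\alpha=(\alpha_1,\dots,\alpha_\ell)$ and $\beta=(\beta_1,\dots,\beta_\ell)$ be compositions of the same length $\ell$, and put $\hat\alpha_i=\alpha_i-i$ and $\hat\beta_j=\beta_j-j$. Suppose that the expansion $\mathfrak{S}_{\alpha/\beta}=\sum_{\sigma\in S_\ell}\operatorname{sgn}(\sigma)\,H_{\hat\alpha_1-\hat\beta_{\sigma(1)}}H_{\hat\alpha_2-\hat\beta_{\sigma(2)}}\cdots H_{\hat\alpha_\ell-\hat\beta_{\sigma(\ell)}}$ contains at least one nonzero term before cancellation, i.e. there is a permutation $\sigma\in S_\ell$ with $\hat\alpha_i-\hat\beta_{\sigma(i)}\ge 0$ for all $i$. Then for every $k$ with $1\le k\le \ell$, the number of indices $i\in\{1,\dots,\ell\}$ such that $\hat\alpha_i$ is smaller than at least $\ell-k+1$ of the entries of $\hat\beta$ (i.e. $|\{j:\hat\beta_j>\hat\alpha_i\}|\ge \ell-k+1$) is at most $k-1$.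
   Context: A composition is a finite sequence of positive integers. $\mathrm{NSym}$ is the free associative algebra over $\mathbb{R}$ generated by noncommuting symbols $H_1,H_2,\dots$, with the conventions $H_0=1$ and $H_a=0$ for $a<0$; for a composition $\gamma$, $H_\gamma=H_{\gamma_1}H_{\gamma_2}\cdots$, and these form a basis. For compositions $\alpha,\beta$ of length $\ell$, the associated matrix is $M_{\alpha/\beta}$ with $(M_{\alpha/\beta})_{i,j}=H_{(\alpha_i-i)-(\beta_j-j)}$, and the skew immaculate function is $\mathfrak{S}_{\alpha/\beta}=\operatorname{ndet}(M_{\alpha/\beta})$, the noncommutative determinant computed by Laplace expansion starting in the top row and proceeding sequentially to the bottom row; equivalently $\operatorname{ndet}(M)=\sum_{\sigma\in S_\ell}\operatorname{sgn}(\sigma)M_{1,\sigma(1)}\cdots M_{\ell,\sigma(\ell)}$. A term of this sum is "nonzero before cancellation" if all its factors have nonnegative subscripts. -}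

module Defs where

open import Data.Nat using (ℕ; suc; _<_)
open import Data.Integer using (ℤ; +_; _-_; _<?_)
open import Data.Fin using (Fin; toℕ)
open import Data.Vec using (count; allFin)

-- A composition of length ℓ: a function Fin ℓ → ℕ with all parts positive.
-- (Index i : Fin ℓ corresponds to the 1-based index toℕ i + 1.)
IsComposition : {ℓ : ℕ} → (Fin ℓ → ℕ) → Set
IsComposition {ℓ} γ = ∀ (i : Fin ℓ) → 0 < γ i

hat : {ℓ : ℕ} → (Fin ℓ → ℕ) → Fin ℓ → ℤ
hat γ i = + γ i - + suc (toℕ i)

numAbove : {ℓ : ℕ} → (Fin ℓ → ℕ) → ℤ → ℕ
numAbove {ℓ} β a = count (λ j → a <? hat β j) (allFin ℓ)

{-# OPTIONS --safe #-}
-- Among the indices i whose α̂ᵢ lies below at least t entries of β̂, pick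
-- one, i*, with α̂ maximal.  Every such index i satisfies
-- β̂_σ(i) ≤ α̂ᵢ ≤ α̂_i*, so σ sends all of them outside the set of
-- (at least t) indices j with β̂ⱼ > α̂_i*; as σ is a bijection there are
-- at most ℓ - t of them.  With t = ℓ - k + 1 this is the bound k - 1.
module Submission where

open import Defs
open import Data.Nat using (ℕ; zero; suc; _≤_; _≤?_; _∸_; _+_; z≤n; s≤s)
import Data.Nat.Properties as ℕ
open import Data.Integer using (ℤ; +_; _-_; _<?_) renaming (_≤_ to _≤ℤ_; _<_ to _<ℤ_)
import Data.Integer.Properties as ℤ
open import Data.Fin using (Fin; zero; suc)
open import Data.Fin.Permutation using (Permutation′; _⟨$⟩ʳ_)
open import Data.Vec using (Vec; []; _∷_; count; allFin; tabulate)
open import Data.Bool using (if_then_else_)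
open import Data.Product using (∃; ∃-syntax; _×_; _,_)
open import Data.Sum using (_⊎_; inj₁; inj₂)
open import Function using (_∘_; id)
open import Relation.Nullary using (Dec; does; yes; no; ¬_; contradiction)
open import Relation.Unary using (Pred; Decidable; _⊆_)
open import Relation.Unary.Properties using (∁?)
open import Relation.Binary.Bundles using (TotalPreorder)
open import Relation.Binary.PropositionalEquality using (_≡_; refl; cong; module ≡-Reasoning)
open import Algebra.Properties.CommutativeMonoid.Sum ℕ.+-0-commutativeMonoid using (sum; sum-permute)

indicator : ∀ {p} {P : Set p} → Dec P → ℕ
indicator P? = if does P? then 1 else 0

module _ {a p} {A : Set a} {P : Pred A p} (P? : Decidable P) where

  count-none : (∀ x → ¬ P x) → ∀ {n} (xs : Vec A n) → count P? xs ≡ 0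
  count-none none []       = refl
  count-none none (x ∷ xs) with P? x
  ... | yes px = contradiction px (none x)
  ... | no  _  = count-none none xs

  count-+-count-∁ : ∀ {n} (xs : Vec A n) → count P? xs + count (∁? P?) xs ≡ n
  count-+-count-∁ []       = refl
  count-+-count-∁ (x ∷ xs) with P? x
  ... | yes _ = cong suc (count-+-count-∁ xs)
  ... | no  _ = begin
    count P? xs + suc (count (∁? P?) xs) ≡⟨ ℕ.+-suc (count P? xs) _ ⟩
    suc (count P? xs + count (∁? P?) xs) ≡⟨ cong suc (count-+-count-∁ xs) ⟩
    suc _                                ∎
    where open ≡-Reasoning

  count-∁ : ∀ {n} (xs : Vec A n) → count (∁? P?) xs ≡ n ∸ count P? xs
  count-∁ {n} xs = begin
    count (∁? P?) xs                                ≡⟨ ℕ.m+n∸m≡n (count P? xs) _ ⟨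
    count P? xs + count (∁? P?) xs ∸ count P? xs    ≡⟨ cong (_∸ count P? xs) (count-+-count-∁ xs) ⟩
    n ∸ count P? xs                                 ∎
    where open ≡-Reasoning

  count-tabulate : ∀ {n} (f : Fin n → A) → count P? (tabulate f) ≡ sum (indicator ∘ P? ∘ f)
  count-tabulate {zero}  f = refl
  count-tabulate {suc n} f with P? (f zero)
  ... | yes _ = cong suc (count-tabulate (f ∘ suc))
  ... | no  _ = count-tabulate (f ∘ suc)

module _ {a p q} {A : Set a} {P : Pred A p} {Q : Pred A q}
         (P? : Decidable P) (Q? : Decidable Q) where

  count-mono : P ⊆ Q → ∀ {n} (xs : Vec A n) → count P? xs ≤ count Q? xs
  count-mono P⊆Q []       = z≤n
  count-mono P⊆Q (x ∷ xs) with P? x | Q? x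
  ... | yes px | no ¬qx = contradiction (P⊆Q px) ¬qx
  ... | yes _  | yes _  = s≤s (count-mono P⊆Q xs)
  ... | no _   | yes _  = ℕ.m≤n⇒m≤1+n (count-mono P⊆Q xs)
  ... | no _   | no _   = count-mono P⊆Q xs

module _ {p} {n} {P : Pred (Fin n) p} (P? : Decidable P) where

  count-allFin-permute : (π : Permutation′ n) →
    count (P? ∘ (π ⟨$⟩ʳ_)) (allFin n) ≡ count P? (allFin n)
  count-allFin-permute π = begin
    count (P? ∘ (π ⟨$⟩ʳ_)) (allFin n)  ≡⟨ count-tabulate (P? ∘ (π ⟨$⟩ʳ_)) id ⟩
    sum (indicator ∘ P? ∘ (π ⟨$⟩ʳ_))   ≡⟨ sum-permute (indicator ∘ P?) π ⟨
    sum (indicator ∘ P?)               ≡⟨ count-tabulate P? id ⟨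
    count P? (allFin n)                ∎
    where open ≡-Reasoning

module _ {p q} {n} {P : Pred (Fin n) p} {Q : Pred (Fin n) q}
         (P? : Decidable P) (Q? : Decidable Q) where

  count-allFin-≤-along : (π : Permutation′ n) →
    (∀ i → P i → Q (π ⟨$⟩ʳ i)) → count P? (allFin n) ≤ count Q? (allFin n)
  count-allFin-≤-along π P⇒Q∘π = ℕ.≤-trans
    (count-mono P? (Q? ∘ (π ⟨$⟩ʳ_)) (P⇒Q∘π _) (allFin n))
    (ℕ.≤-reflexive (count-allFin-permute Q? π))

module _ {c ℓ₁ ℓ₂} (O : TotalPreorder c ℓ₁ ℓ₂) where
  open TotalPreorder O using (Carrier; _≲_; total) renaming (refl to ≲-refl; trans to ≲-trans)

  maximal-witness : ∀ {p n} {P : Pred (Fin n) p} → Decidable P → (g : Fin n → Carrier) →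
    (∀ i → ¬ P i) ⊎ ∃[ m ] P m × (∀ i → P i → g i ≲ g m)
  maximal-witness {n = zero}  P? g = inj₁ λ ()
  maximal-witness {n = suc n} P? g with maximal-witness (P? ∘ suc) (g ∘ suc) | P? zero
  ... | inj₁ none | no ¬p₀ = inj₁ λ { zero → ¬p₀ ; (suc i) → none i }
  ... | inj₁ none | yes p₀ =
    inj₂ (zero , p₀ , λ { zero _ → ≲-refl ; (suc i) pᵢ → contradiction pᵢ (none i) })
  ... | inj₂ (m , pₘ , max) | no ¬p₀ =
    inj₂ (suc m , pₘ , λ { zero p₀ → contradiction p₀ ¬p₀ ; (suc i) → max i })
  ... | inj₂ (m , pₘ , max) | yes p₀ with total (g zero) (g (suc m))
  ...   | inj₁ g₀≲gₘ = inj₂ (suc m , pₘ , λ { zero _ → g₀≲gₘ ; (suc i) → max i })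
  ...   | inj₂ gₘ≲g₀ =
    inj₂ (zero , p₀ , λ { zero _ → ≲-refl ; (suc i) pᵢ → ≲-trans (max i pᵢ) gₘ≲g₀ })

module _ {n} (a b : Fin n → ℤ) (t : ℕ) where

  #above : ℤ → ℕ
  #above x = count (λ j → x <? b j) (allFin n)

  far-below? : Decidable (λ i → t ≤ #above (a i))
  far-below? i = t ≤? #above (a i)

  count-far-below-≤ : (σ : Permutation′ n) → (∀ i → b (σ ⟨$⟩ʳ i) ≤ℤ a i) →
    count far-below? (allFin n) ≤ n ∸ t
  count-far-below-≤ σ b∘σ≤a with maximal-witness ℤ.≤-totalPreorder far-below? a
  ... | inj₁ none = ℕ.≤-trans (ℕ.≤-reflexive (count-none far-below? none (allFin n))) z≤n
  ... | inj₂ (m , far-m , max) = begin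
    count far-below? (allFin n)   ≤⟨ count-allFin-≤-along far-below? (∁? above?) σ not-above ⟩
    count (∁? above?) (allFin n)  ≡⟨ count-∁ above? (allFin n) ⟩
    n ∸ #above (a m)              ≤⟨ ℕ.∸-monoʳ-≤ n far-m ⟩
    n ∸ t                         ∎
    where
      open ℕ.≤-Reasoning
      above? : Decidable (λ j → a m <ℤ b j)
      above? j = a m <? b j
      not-above : ∀ i → t ≤ #above (a i) → ¬ a m <ℤ b (σ ⟨$⟩ʳ i)
      not-above i far-i aₘ<bσᵢ = ℤ.<⇒≱ aₘ<bσᵢ (ℤ.≤-trans (b∘σ≤a i) (max i far-i))

m∸suc[m∸n]≡n∸1 : ∀ {m n} → n ≤ m → m ∸ suc (m ∸ n) ≡ n ∸ 1
m∸suc[m∸n]≡n∸1 {m} {n} n≤m = begin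
  m ∸ suc (m ∸ n)    ≡⟨ cong (m ∸_) (ℕ.+-comm 1 (m ∸ n)) ⟩
  m ∸ (m ∸ n + 1)    ≡⟨ ℕ.∸-+-assoc m (m ∸ n) 1 ⟨
  m ∸ (m ∸ n) ∸ 1    ≡⟨ cong (_∸ 1) (ℕ.m∸[m∸n]≡n n≤m) ⟩
  n ∸ 1              ∎
  where open ≡-Reasoning

theorem2 : (ℓ : ℕ) (α β : Fin ℓ → ℕ) → IsComposition α → IsComposition β →
    (∃ λ (σ : Permutation′ ℓ) → ∀ (i : Fin ℓ) → + 0 ≤ℤ hat α i - hat β (σ ⟨$⟩ʳ i)) →
    ∀ (k : ℕ) → 1 ≤ k → k ≤ ℓ →
    count (λ i → suc (ℓ ∸ k) ≤? numAbove β (hat α i)) (allFin ℓ) ≤ k ∸ 1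
theorem2 ℓ α β _ _ (σ , nonzero-term) k _ k≤ℓ = begin
  count (λ i → suc (ℓ ∸ k) ≤? numAbove β (hat α i)) (allFin ℓ)
    ≤⟨ count-far-below-≤ (hat α) (hat β) (suc (ℓ ∸ k)) σ (ℤ.0≤i-j⇒j≤i ∘ nonzero-term) ⟩
  ℓ ∸ suc (ℓ ∸ k)
    ≡⟨ m∸suc[m∸n]≡n∸1 k≤ℓ ⟩
  k ∸ 1 ∎
  where open ℕ.≤-Reasoning
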